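{- Let $m,n\in\mathbb{N}$, $p,k\in[m]$ and $q,\ell\in[n]$, and suppose $(p,q)\leq_R(k,\ell)$. Then $k\ell+p(n-\ell)+q(m-k)\leq mn$.
   Context: Fix $m,n\in\mathbb{N}$. For $a,c\in[m]$ and $b,d\in[n]$, define $(a,b)<_R(c,d)$ if either $\min\{m-a,n-b\}>\min\{m-c,n-d\}$, or $\min\{m-a,n-b\}=\min\{m-c,n-d\}$ and $\max\{m-a,n-b\}>\max\{m-c,n-d\}$. Write $(a,b)\leq_R(c,d)$ if $(a,b)<_R(c,d)$ or $(a,b)=(c,d)$. -}

module Defs where

open import Data.Nat using (ℕ; _∸_; _⊓_; _⊔_; _<_)
open import Data.Product using (_×_)
open import Data.Sum using (_⊎_)
open import Relation.Binary.PropositionalEquality using (_≡_)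

-- The order <_R on [m] × [n] (m, n fixed). Subtractions are exact since a,c ≤ m, b,d ≤ n.
_<R[_,_]_ : ℕ × ℕ → ℕ → ℕ → ℕ × ℕ → Set
_<R[_,_]_ (a Data.Product., b) m n (c Data.Product., d) =
  ((m ∸ c) ⊓ (n ∸ d) < (m ∸ a) ⊓ (n ∸ b))
  ⊎ (((m ∸ a) ⊓ (n ∸ b) ≡ (m ∸ c) ⊓ (n ∸ d)) × ((m ∸ c) ⊔ (n ∸ d) < (m ∸ a) ⊔ (n ∸ b)))

_≤R[_,_]_ : ℕ × ℕ → ℕ → ℕ → ℕ × ℕ → Set
x ≤R[ m , n ] y = (x <R[ m , n ] y) ⊎ (x ≡ y)

{-# OPTIONS --safe #-}
-- Put c = m ∸ k, d = n ∸ ℓ, a = m ∸ p and b = n ∸ q. Expanding m n = (k + c)(ℓ + d)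
-- and using p + a = m, q + b = n gives  k ℓ + p d + q c + (a d + b c) = m n + c d,
-- so it suffices that c d ≤ a d + b c. Only the first component of (p , q) ≤R (k , ℓ)
-- matters: it gives c ⊓ d ≤ a ⊓ b, so c ≤ a when c ≤ d and d ≤ b when d ≤ c.
module Submission where

open import Defs
open import Data.List using ([]; _∷_)
open import Data.Nat using (ℕ; _+_; _*_; _∸_; _≤_; _⊓_)
open import Data.Nat.Properties
open import Data.Nat.Tactic.RingSolver using (solve)
open import Data.Product using (_,_)
open import Data.Sum using (inj₁; inj₂)
open import Relation.Binary.PropositionalEquality using (_≡_; refl; sym; cong₂)

≤R⇒∸⊓∸-≥ : ∀ {m n p q k ℓ} → (p , q) ≤R[ m , n ] (k , ℓ) →
           (m ∸ k) ⊓ (n ∸ ℓ) ≤ (m ∸ p) ⊓ (n ∸ q)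
≤R⇒∸⊓∸-≥ (inj₁ (inj₁ lt))       = <⇒≤ lt
≤R⇒∸⊓∸-≥ (inj₁ (inj₂ (eq , _))) = ≤-reflexive (sym eq)
≤R⇒∸⊓∸-≥ (inj₂ refl)            = ≤-refl

⊓≤⊓⇒*≤*+* : ∀ a b c d → c ⊓ d ≤ a ⊓ b → c * d ≤ a * d + b * c
⊓≤⊓⇒*≤*+* a b c d c⊓d≤a⊓b with ≤-total c d
... | inj₁ c≤d = begin
  c * d         ≤⟨ *-monoˡ-≤ d c≤a ⟩
  a * d         ≤⟨ m≤m+n (a * d) (b * c) ⟩
  a * d + b * c ∎
  where
  open ≤-Reasoning
  c≤a : c ≤ a
  c≤a = begin
    c     ≡⟨ sym (m≤n⇒m⊓n≡m c≤d) ⟩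
    c ⊓ d ≤⟨ c⊓d≤a⊓b ⟩
    a ⊓ b ≤⟨ m⊓n≤m a b ⟩
    a     ∎
... | inj₂ d≤c = begin
  c * d         ≤⟨ *-monoʳ-≤ c d≤b ⟩
  c * b         ≡⟨ *-comm c b ⟩
  b * c         ≤⟨ m≤n+m (b * c) (a * d) ⟩
  a * d + b * c ∎
  where
  open ≤-Reasoning
  d≤b : d ≤ b
  d≤b = begin
    d     ≡⟨ sym (m≥n⇒m⊓n≡n d≤c) ⟩
    c ⊓ d ≤⟨ c⊓d≤a⊓b ⟩
    a ⊓ b ≤⟨ m⊓n≤n a b ⟩
    b     ∎

complement-bound : ∀ {m n} k ℓ p q a b c d →
                   k + c ≡ m → ℓ + d ≡ n → p + a ≡ m → q + b ≡ n →
                   c * d ≤ a * d + b * c → k * ℓ + p * d + q * c ≤ m * n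
complement-bound k ℓ p q a b c d refl refl p+a≡m q+b≡n cd≤ad+bc =
  +-cancelʳ-≤ (a * d + b * c) (k * ℓ + p * d + q * c) ((k + c) * (ℓ + d)) (begin
    k * ℓ + p * d + q * c + (a * d + b * c) ≡⟨ solve (k ∷ ℓ ∷ p ∷ q ∷ a ∷ b ∷ c ∷ d ∷ []) ⟩
    k * ℓ + (p + a) * d + (q + b) * c       ≡⟨ cong₂ (λ x y → k * ℓ + x * d + y * c) p+a≡m q+b≡n ⟩
    k * ℓ + (k + c) * d + (ℓ + d) * c       ≡⟨ solve (k ∷ ℓ ∷ c ∷ d ∷ []) ⟩
    (k + c) * (ℓ + d) + c * d               ≤⟨ +-monoʳ-≤ ((k + c) * (ℓ + d)) cd≤ad+bc ⟩
    (k + c) * (ℓ + d) + (a * d + b * c)     ∎)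
  where open ≤-Reasoning

mainTheorem11 : (m n p k q ℓ : ℕ) →
    1 ≤ p → p ≤ m → 1 ≤ k → k ≤ m → 1 ≤ q → q ≤ n → 1 ≤ ℓ → ℓ ≤ n →
    (p , q) ≤R[ m , n ] (k , ℓ) →
    k * ℓ + p * (n ∸ ℓ) + q * (m ∸ k) ≤ m * n
mainTheorem11 m n p k q ℓ _ p≤m _ k≤m _ q≤n _ ℓ≤n pq≤Rkℓ =
  complement-bound k ℓ p q (m ∸ p) (n ∸ q) (m ∸ k) (n ∸ ℓ)
    (m+[n∸m]≡n k≤m) (m+[n∸m]≡n ℓ≤n) (m+[n∸m]≡n p≤m) (m+[n∸m]≡n q≤n)
    (⊓≤⊓⇒*≤*+* (m ∸ p) (n ∸ q) (m ∸ k) (n ∸ ℓ) (≤R⇒∸⊓∸-≥ pq≤Rkℓ))
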